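{- Let $(V,\mathcal C,\kappa)$ be an instance of BATLB, and let $(V',\mathcal C')$ be obtained from $(V,\mathcal C)$ by applying the following reduction rule as long as possible: if $\mathcal C$ contains a complete triple of constraints, delete these three constraints from $\mathcal C$ and delete from $V$ every variable that appears only in constraints of this triple. Then $(V,\mathcal C,\kappa)$ is a Yes-instance of BATLB if and only if $(V',\mathcal C',\kappa)$ is a Yes-instance of BATLB.
   Context: A betweenness constraint over a finite set $V$ of variables is written $(v_i,\{v_j,v_k\})$ for distinct $v_i,v_j,v_k\in V$; its variable set is $vars((v_i,\{v_j,v_k\}))=\{v_i,v_j,v_k\}$. A bijection $\alpha:V\to\{1,\dots,|V|\}$ satisfies $(v_i,\{v_j,v_k\})$ if $\alpha(v_j)<\alpha(v_i)<\alpha(v_k)$ or $\alpha(v_k)<\alpha(v_i)<\alpha(v_j)$. BATLB: given a set $V$ of variables, a set $\mathcal C$ of betweenness constraints over $V$, and an integer $\kappa\ge0$, decide whether some bijection $\alpha:V\to\{1,\dots,|V|\}$ satisfies at least $|\mathcal C|/3+\kappa$ constraints of $\mathcal C$. A triple $A,B,C$ of distinct constraints of $\mathcal C$ is complete if $vars(A)=vars(B)=vars(C)$. -}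

module Defs where

open import Data.Nat using (ℕ; _<_; _≤_; _+_; _*_; _<?_)
open import Data.Product using (_×_; Σ; ∃; ∃-syntax; _,_)
open import Data.Sum using (_⊎_)
open import Data.List using (List; _∷_; length; filter)
open import Data.List.Membership.Propositional using (_∈_; _∉_)
open import Data.List.Relation.Unary.Unique.Propositional using (Unique)
open import Data.List.Relation.Unary.AllPairs using (AllPairs)
open import Data.List.Relation.Binary.Permutation.Propositional using (_↭_)
open import Relation.Binary.Construct.Closure.ReflexiveTransitive using (Star)
open import Relation.Binary.PropositionalEquality using (_≡_; _≢_)
open import Relation.Nullary using (¬_; Dec)
open import Relation.Nullary.Decidable using (_×-dec_; _⊎-dec_)
open import Function.Bundles using (_⇔_)

-- Variables are natural numbers; a set V of variables is a duplicate-free list.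
Var : Set
Var = ℕ

-- The betweenness constraint (mid , {e₁ , e₂}).
record Constraint : Set where
  constructor btw
  field
    mid : Var
    e₁  : Var
    e₂  : Var
open Constraint public

_≈c_ : Constraint → Constraint → Set
c ≈c d = mid c ≡ mid d × ((e₁ c ≡ e₁ d × e₂ c ≡ e₂ d) ⊎ (e₁ c ≡ e₂ d × e₂ c ≡ e₁ d))

InVars : Var → Constraint → Set
InVars v c = v ≡ mid c ⊎ v ≡ e₁ c ⊎ v ≡ e₂ c

SameVars : Constraint → Constraint → Set
SameVars c d = ∀ v → InVars v c ⇔ InVars v d

ConstraintSet : List Constraint → Set
ConstraintSet C = AllPairs (λ c d → ¬ (c ≈c d)) C

-- (V, C) is a well-formed BATLB instance (κ ∈ ℕ, so κ ≥ 0 automatically).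
WellFormed : List Var → List Constraint → Set
WellFormed V C =
  Unique V × ConstraintSet C ×
  (∀ c → c ∈ C →
     mid c ≢ e₁ c × mid c ≢ e₂ c × e₁ c ≢ e₂ c ×
     mid c ∈ V × e₁ c ∈ V × e₂ c ∈ V)

Sat : (Var → ℕ) → Constraint → Set
Sat α c = (α (e₁ c) < α (mid c) × α (mid c) < α (e₂ c))
        ⊎ (α (e₂ c) < α (mid c) × α (mid c) < α (e₁ c))

sat? : (α : Var → ℕ) (c : Constraint) → Dec (Sat α c)
sat? α c = ((α (e₁ c) <? α (mid c)) ×-dec (α (mid c) <? α (e₂ c)))
      ⊎-dec ((α (e₂ c) <? α (mid c)) ×-dec (α (mid c) <? α (e₁ c)))

numSat : (Var → ℕ) → List Constraint → ℕ
numSat α C = length (filter (sat? α) C)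

IsBijection : List Var → (Var → ℕ) → Set
IsBijection V α =
  (∀ v → v ∈ V → 1 ≤ α v × α v ≤ length V) ×
  (∀ u v → u ∈ V → v ∈ V → α u ≡ α v → u ≡ v) ×
  (∀ k → 1 ≤ k → k ≤ length V → ∃[ v ] (v ∈ V × α v ≡ k))

-- Yes-instance: some bijection satisfies at least |C|/3 + κ constraints,
-- i.e. 3·numSat ≥ |C| + 3κ (exact rational comparison).
YesInstance : List Var → List Constraint → ℕ → Set
YesInstance V C κ =
  ∃[ α ] (IsBijection V α × length C + 3 * κ ≤ 3 * numSat α C)

CompleteTriple : Constraint → Constraint → Constraint → Set
CompleteTriple A B D =
  ¬ (A ≈c B) × ¬ (A ≈c D) × ¬ (B ≈c D) × SameVars A B × SameVars A D

HasCompleteTriple : List Constraint → Set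
HasCompleteTriple C =
  ∃[ A ] ∃[ B ] ∃[ D ] (A ∈ C × B ∈ C × D ∈ C × CompleteTriple A B D)

Step : (List Var × List Constraint) → (List Var × List Constraint) → Set
Step (V , C) (V' , C') =
  ∃[ A ] ∃[ B ] ∃[ D ]
    ( CompleteTriple A B D
    × C ↭ (A ∷ B ∷ D ∷ C')
    × Unique V'
    × (∀ v → v ∈ V' ⇔ (v ∈ V × ¬ (InVars v A × (∀ c → c ∈ C' → ¬ InVars v c)))))

Exhaustive : (List Var × List Constraint) → (List Var × List Constraint) → Set
Exhaustive (V , C) (V' , C') = Star Step (V , C) (V' , C') × ¬ HasCompleteTriple C'

-- If A, B, D are three distinct constraints on the same three variables
-- {a, b, c}, then up to the equality of constraints they are (a,{b,c}),
-- (b,{a,c}) and (c,{a,b}); an ordering that is injective on {a,b,c} puts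
-- exactly one of a, b, c in the middle, so it satisfies EXACTLY ONE of them.
-- Hence deleting the triple lowers both |C| by 3 and the number of satisfied
-- constraints by 1, which leaves the test |C| + 3κ ≤ 3·numSat unchanged.
-- Deleting the variables that occurred only in the triple does no harm: an
-- ordering of V becomes one of V' by ranking (and conversely, after extending
-- an ordering of V' injectively to all variables), and ranking preserves the
-- relative order of the variables, so no remaining constraint is lost.
module Submission where

open import Defs
open import Data.Nat using (ℕ; suc; _<_; _≤_; _+_; _*_; _≤?_; z≤n; s≤s)
open import Data.Nat.Properties
open import Data.Product using (_×_; ∃-syntax; _,_; proj₁; proj₂)
open import Data.Sum using (_⊎_; inj₁; inj₂; swap)
open import Data.List using (List; []; _∷_; length; filter)
open import Data.List.Properties using (filter-accept; filter-reject; length-filter)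
open import Data.List.Membership.Propositional using (_∈_)
open import Data.List.Membership.Propositional.Properties using (∈-filter⁺)
open import Data.List.Membership.DecPropositional _≟_ using (_∈?_)
open import Data.List.Relation.Unary.Any using (here; there)
open import Data.List.Relation.Unary.All using (lookup)
open import Data.List.Relation.Unary.AllPairs using (_∷_)
open import Data.List.Relation.Unary.Unique.Propositional using (Unique)
open import Data.List.Relation.Binary.Permutation.Propositional using (_↭_; ↭-sym)
open import Data.List.Relation.Binary.Permutation.Propositional.Properties
  using (∈-resp-↭; ↭-length; filter-↭)
open import Relation.Binary.Construct.Closure.ReflexiveTransitive using (Star; ε; _◅_)
open import Relation.Binary.PropositionalEquality
open import Relation.Binary using (tri<; tri≈; tri>)
open import Relation.Nullary using (¬_; yes; no; contradiction)
open import Relation.Unary using (Pred; Decidable)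
open import Data.Empty using (⊥-elim)
open import Level using (0ℓ)
open import Function using (_∘_)
open import Function.Bundles using (_⇔_; Equivalence; mk⇔)
open import Function.Construct.Identity using (⇔-id)
open import Function.Construct.Composition using (_⇔-∘_)

open Equivalence using (to; from)

module _ {A : Set} {P Q : Pred A 0ℓ} (P? : Decidable P) (Q? : Decidable Q) where

  count-mono : ∀ xs → (∀ {x} → x ∈ xs → P x → Q x) →
               length (filter P? xs) ≤ length (filter Q? xs)
  count-mono []       P⇒Q = z≤n
  count-mono (x ∷ xs) P⇒Q with P? x | Q? x
  ... | yes _ | yes _  = s≤s (count-mono xs (P⇒Q ∘ there))
  ... | yes p | no ¬q  = contradiction (P⇒Q (here refl) p) ¬q
  ... | no _  | yes _  = m≤n⇒m≤1+n (count-mono xs (P⇒Q ∘ there))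
  ... | no _  | no _   = count-mono xs (P⇒Q ∘ there)

  count-mono-strict : ∀ xs → (∀ {x} → x ∈ xs → P x → Q x) →
                      ∀ {y} → y ∈ xs → Q y → ¬ P y →
                      length (filter P? xs) < length (filter Q? xs)
  count-mono-strict (x ∷ xs) P⇒Q (here refl) qy ¬py with P? x | Q? x
  ... | yes py | _     = contradiction py ¬py
  ... | no _   | yes _ = s≤s (count-mono xs (P⇒Q ∘ there))
  ... | no _   | no ¬q = contradiction qy ¬q
  count-mono-strict (x ∷ xs) P⇒Q (there y∈) qy ¬py with P? x | Q? x
  ... | yes _ | yes _ = s≤s (count-mono-strict xs (P⇒Q ∘ there) y∈ qy ¬py)
  ... | yes p | no ¬q = contradiction (P⇒Q (here refl) p) ¬q
  ... | no _  | yes _ = m≤n⇒m≤1+n (count-mono-strict xs (P⇒Q ∘ there) y∈ qy ¬py)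
  ... | no _  | no _  = count-mono-strict xs (P⇒Q ∘ there) y∈ qy ¬py

member⇒length-pos : ∀ {A : Set} {x : A} {xs} → x ∈ xs → 1 ≤ length xs
member⇒length-pos (here _)  = s≤s z≤n
member⇒length-pos (there _) = s≤s z≤n

InjectiveOn : List Var → (Var → ℕ) → Set
InjectiveOn W β = ∀ u v → u ∈ W → v ∈ W → β u ≡ β v → u ≡ v

injective-tail : ∀ {x W β} → InjectiveOn (x ∷ W) β → InjectiveOn W β
injective-tail inj u v u∈ v∈ = inj u v (there u∈) (there v∈)

rank : List Var → (Var → ℕ) → Var → ℕ
rank W β v = length (filter (λ u → β u ≤? β v) W)

module _ (β : Var → ℕ) where

  rank-mono : ∀ W {u v} → β u ≤ β v → rank W β u ≤ rank W β v
  rank-mono W β≤ = count-mono _ _ W (λ _ le → ≤-trans le β≤)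

  rank-strict : ∀ W {u v} → v ∈ W → β u < β v → rank W β u < rank W β v
  rank-strict W v∈ β< = count-mono-strict _ _ W (λ _ le → ≤-trans le (<⇒≤ β<))
                          v∈ ≤-refl (<⇒≱ β<)

  -- Ranks of elements of W lie in {1,…,|W|}; v itself is counted.
  rank-range : ∀ W {v} → v ∈ W → 1 ≤ rank W β v × rank W β v ≤ length W
  rank-range W v∈ = member⇒length-pos (∈-filter⁺ (λ u → β u ≤? β _) v∈ ≤-refl)
                  , length-filter _ W

  rank-below : ∀ {x} W {v} → β x ≤ β v → rank (x ∷ W) β v ≡ suc (rank W β v)
  rank-below W le = cong length (filter-accept (λ u → β u ≤? β _) le)

  rank-above : ∀ {x} W {v} → ¬ β x ≤ β v → rank (x ∷ W) β v ≡ rank W β v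
  rank-above W ¬le = cong length (filter-reject (λ u → β u ≤? β _) ¬le)

  rank-injective : ∀ W → InjectiveOn W β → InjectiveOn W (rank W β)
  rank-injective W inj u v u∈ v∈ eq with <-cmp (β u) (β v)
  ... | tri< β< _ _ = contradiction eq (<⇒≢ (rank-strict W v∈ β<))
  ... | tri≈ _ β≡ _ = inj u v u∈ v∈ β≡
  ... | tri> _ _ β> = contradiction (sym eq) (<⇒≢ (rank-strict W u∈ β>))

  -- Every k ∈ {1,…,|W|} is a rank.  Induction on W = x ∷ W₀: k is the rank
  -- of x itself, or a rank in W₀ of an element below x, or 1 + a rank in W₀
  -- of an element above x.
  rank-surjective : ∀ W → Unique W → InjectiveOn W β →
                    ∀ k → 1 ≤ k → k ≤ length W → ∃[ v ] (v ∈ W × rank W β v ≡ k)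
  rank-surjective []       _          _   (suc _) _ ()
  rank-surjective (x ∷ W) (x∉W ∷ uW) inj k 1≤k k≤ with <-cmp k (suc (rank W β x))
  ... | tri≈ _ k≡ _ = x , here refl , trans (rank-below W ≤-refl) (sym k≡)
  ... | tri< k< _ _ with rank-surjective W uW (injective-tail inj) k 1≤k
                           (≤-trans (≤-pred k<) (length-filter _ W))
  ...   | v , v∈ , rv≡k = v , there v∈ , trans (rank-above W x≰v) rv≡k
    where
    x≰v : ¬ β x ≤ β v
    x≰v le with m≤n⇒m<n∨m≡n le
    ... | inj₁ β< = <⇒≱ (rank-strict W v∈ β<) (subst (_≤ rank W β x) (sym rv≡k) (≤-pred k<))
    ... | inj₂ β≡ = lookup x∉W v∈ (inj x v (here refl) (there v∈) β≡)
  rank-surjective (x ∷ W) (x∉W ∷ uW) inj (suc k) _ (s≤s k≤) | tri> _ _ k>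
    with rank-surjective W uW (injective-tail inj) k (≤-trans (s≤s z≤n) (≤-pred k>)) k≤
  ... | v , v∈ , rv≡k = v , there v∈ , trans (rank-below W x≤v) (cong suc rv≡k)
    where
    x≤v : β x ≤ β v
    x≤v with β x ≤? β v
    ... | yes le = le
    ... | no ¬le = contradiction (subst (_≤ rank W β x) rv≡k (rank-mono W (<⇒≤ (≰⇒> ¬le))))
                                 (<⇒≱ (≤-pred k>))

  rank-bijection : ∀ W → Unique W → InjectiveOn W β → IsBijection W (rank W β)
  rank-bijection W uW inj = (λ _ → rank-range W) , rank-injective W inj , rank-surjective W uW inj

Distinct : Constraint → Set
Distinct c = mid c ≢ e₁ c × mid c ≢ e₂ c × e₁ c ≢ e₂ c

≈c-sym : ∀ {X Y} → X ≈c Y → Y ≈c X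
≈c-sym {btw _ _ _} {btw _ _ _} (refl , inj₁ (refl , refl)) = refl , inj₁ (refl , refl)
≈c-sym {btw _ _ _} {btw _ _ _} (refl , inj₂ (refl , refl)) = refl , inj₂ (refl , refl)

≈c-trans : ∀ {X Y Z} → X ≈c Y → Y ≈c Z → X ≈c Z
≈c-trans {btw _ _ _} {btw _ _ _} {btw _ _ _} (refl , inj₁ (refl , refl)) Y≈Z = Y≈Z
≈c-trans {btw _ _ _} {btw _ _ _} {btw _ _ _} (refl , inj₂ (refl , refl)) (refl , inj₁ (refl , refl)) =
  refl , inj₂ (refl , refl)
≈c-trans {btw _ _ _} {btw _ _ _} {btw _ _ _} (refl , inj₂ (refl , refl)) (refl , inj₂ (refl , refl)) =
  refl , inj₁ (refl , refl)

sat-≈ : ∀ α {X Y} → X ≈c Y → Sat α X ⇔ Sat α Y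
sat-≈ α {btw _ _ _} {btw _ _ _} (refl , inj₁ (refl , refl)) = ⇔-id _
sat-≈ α {btw _ _ _} {btw _ _ _} (refl , inj₂ (refl , refl)) = mk⇔ swap swap

remaining-pair : ∀ {a b c p q} → InVars p (btw a b c) → InVars q (btw a b c) →
                 p ≢ a → q ≢ a → p ≢ q → (p ≡ b × q ≡ c) ⊎ (p ≡ c × q ≡ b)
remaining-pair (inj₁ p≡a)         _                  p≢a _   _   = contradiction p≡a p≢a
remaining-pair _                  (inj₁ q≡a)         _   q≢a _   = contradiction q≡a q≢a
remaining-pair (inj₂ (inj₁ refl)) (inj₂ (inj₁ refl)) _   _   p≢q = contradiction refl p≢q
remaining-pair (inj₂ (inj₁ p≡b))  (inj₂ (inj₂ q≡c))  _   _   _   = inj₁ (p≡b , q≡c)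
remaining-pair (inj₂ (inj₂ p≡c))  (inj₂ (inj₁ q≡b))  _   _   _   = inj₂ (p≡c , q≡b)
remaining-pair (inj₂ (inj₂ refl)) (inj₂ (inj₂ refl)) _   _   p≢q = contradiction refl p≢q

vars-swap : ∀ {x a b c} → InVars x (btw a b c) → InVars x (btw b a c)
vars-swap (inj₁ x≡a)        = inj₂ (inj₁ x≡a)
vars-swap (inj₂ (inj₁ x≡b)) = inj₁ x≡b
vars-swap (inj₂ (inj₂ x≡c)) = inj₂ (inj₂ x≡c)

vars-rotate : ∀ {x a b c} → InVars x (btw a b c) → InVars x (btw c a b)
vars-rotate (inj₁ x≡a)        = inj₂ (inj₁ x≡a)
vars-rotate (inj₂ (inj₁ x≡b)) = inj₂ (inj₂ x≡b)
vars-rotate (inj₂ (inj₂ x≡c)) = inj₁ x≡c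

classify : ∀ {a b c} B → Distinct B → SameVars (btw a b c) B → ¬ (btw a b c ≈c B) →
           (B ≈c btw b a c) ⊎ (B ≈c btw c a b)
classify (btw m p q) (m≢p , m≢q , p≢q) same A≉B
  with from (same m) (inj₁ refl) | from (same p) (inj₂ (inj₁ refl)) | from (same q) (inj₂ (inj₂ refl))
... | inj₁ refl        | p∈ | q∈ =
  contradiction (≈c-sym (refl , remaining-pair p∈ q∈ (≢-sym m≢p) (≢-sym m≢q) p≢q)) A≉B
... | inj₂ (inj₁ refl) | p∈ | q∈ =
  inj₁ (refl , remaining-pair (vars-swap p∈) (vars-swap q∈) (≢-sym m≢p) (≢-sym m≢q) p≢q)
... | inj₂ (inj₂ refl) | p∈ | q∈ =
  inj₂ (refl , remaining-pair (vars-rotate p∈) (vars-rotate q∈) (≢-sym m≢p) (≢-sym m≢q) p≢q)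

ExactlyOne : Set → Set → Set → Set
ExactlyOne P Q R = (P × ¬ Q × ¬ R) ⊎ (¬ P × Q × ¬ R) ⊎ (¬ P × ¬ Q × R)

module _ {P Q R : Set} where

  exactly-one : ¬ (P × Q) → ¬ (P × R) → ¬ (Q × R) → P ⊎ Q ⊎ R → ExactlyOne P Q R
  exactly-one ¬PQ ¬PR _   (inj₁ p)        = inj₁ (p , (λ q → ¬PQ (p , q)) , (λ r → ¬PR (p , r)))
  exactly-one ¬PQ _   ¬QR (inj₂ (inj₁ q)) = inj₂ (inj₁ ((λ p → ¬PQ (p , q)) , q , (λ r → ¬QR (q , r))))
  exactly-one _   ¬PR ¬QR (inj₂ (inj₂ r)) = inj₂ (inj₂ ((λ p → ¬PR (p , r)) , (λ q → ¬QR (q , r)) , r))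

  exactly-one-swap : ExactlyOne P Q R → ExactlyOne P R Q
  exactly-one-swap (inj₁ (p , ¬q , ¬r))        = inj₁ (p , ¬r , ¬q)
  exactly-one-swap (inj₂ (inj₁ (¬p , q , ¬r))) = inj₂ (inj₂ (¬p , ¬r , q))
  exactly-one-swap (inj₂ (inj₂ (¬p , ¬q , r))) = inj₂ (inj₁ (¬p , r , ¬q))

  exactly-one-map : ∀ {P' Q' R'} → P ⇔ P' → Q ⇔ Q' → R ⇔ R' →
                    ExactlyOne P Q R → ExactlyOne P' Q' R'
  exactly-one-map P⇔ Q⇔ R⇔ (inj₁ (p , ¬q , ¬r)) =
    inj₁ (to P⇔ p , ¬q ∘ from Q⇔ , ¬r ∘ from R⇔)
  exactly-one-map P⇔ Q⇔ R⇔ (inj₂ (inj₁ (¬p , q , ¬r))) =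
    inj₂ (inj₁ (¬p ∘ from P⇔ , to Q⇔ q , ¬r ∘ from R⇔))
  exactly-one-map P⇔ Q⇔ R⇔ (inj₂ (inj₂ (¬p , ¬q , r))) =
    inj₂ (inj₂ (¬p ∘ from P⇔ , ¬q ∘ from Q⇔ , to R⇔ r))

middle-unique : ∀ α x y z → ¬ (Sat α (btw x y z) × Sat α (btw y x z))
middle-unique α x y z (inj₁ (y<x , x<z) , inj₁ (x<y , y<z)) = <-asym y<x x<y
middle-unique α x y z (inj₁ (y<x , x<z) , inj₂ (z<y , _)) = <-asym (<-trans z<y y<x) x<z
middle-unique α x y z (inj₂ (z<x , x<y) , inj₁ (_ , y<z)) = <-asym (<-trans z<x x<y) y<z
middle-unique α x y z (inj₂ (z<x , x<y) , inj₂ (z<y , y<x)) = <-asym x<y y<x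

<-or-> : ∀ {x y : ℕ} → x ≢ y → x < y ⊎ y < x
<-or-> {x} {y} x≢y with <-cmp x y
... | tri< x<y _ _ = inj₁ x<y
... | tri≈ _ x≡y _ = contradiction x≡y x≢y
... | tri> _ _ y<x = inj₂ y<x

some-middle : ∀ α a b c → α a ≢ α b → α a ≢ α c → α b ≢ α c →
              Sat α (btw a b c) ⊎ Sat α (btw b a c) ⊎ Sat α (btw c a b)
some-middle α a b c a≢b a≢c b≢c with <-or-> a≢b | <-or-> a≢c | <-or-> b≢c
... | inj₁ a<b | inj₁ a<c | inj₁ b<c = inj₂ (inj₁ (inj₁ (a<b , b<c)))
... | inj₁ a<b | inj₁ a<c | inj₂ c<b = inj₂ (inj₂ (inj₁ (a<c , c<b)))
... | inj₁ a<b | inj₂ c<a | inj₁ b<c = ⊥-elim (<-asym (<-trans c<a a<b) b<c)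
... | inj₁ a<b | inj₂ c<a | inj₂ c<b = inj₁ (inj₂ (c<a , a<b))
... | inj₂ b<a | inj₁ a<c | inj₁ b<c = inj₁ (inj₁ (b<a , a<c))
... | inj₂ b<a | inj₁ a<c | inj₂ c<b = ⊥-elim (<-asym (<-trans b<a a<c) c<b)
... | inj₂ b<a | inj₂ c<a | inj₁ b<c = inj₂ (inj₂ (inj₂ (b<c , c<a)))
... | inj₂ b<a | inj₂ c<a | inj₂ c<b = inj₂ (inj₁ (inj₂ (c<b , b<a)))

canonical-exactly-one : ∀ α a b c → α a ≢ α b → α a ≢ α c → α b ≢ α c →
  ExactlyOne (Sat α (btw a b c)) (Sat α (btw b a c)) (Sat α (btw c a b))
canonical-exactly-one α a b c a≢b a≢c b≢c =
  exactly-one (middle-unique α a b c)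
              (λ (s , t) → middle-unique α a c b (swap s , t))
              (λ (s , t) → middle-unique α b c a (swap s , swap t))
              (some-middle α a b c a≢b a≢c b≢c)

complete-triple-exactly-one : ∀ α {A B D} → CompleteTriple A B D → Distinct B → Distinct D →
  α (mid A) ≢ α (e₁ A) → α (mid A) ≢ α (e₂ A) → α (e₁ A) ≢ α (e₂ A) →
  ExactlyOne (Sat α A) (Sat α B) (Sat α D)
complete-triple-exactly-one α {btw a b c} {B} {D} (A≉B , A≉D , B≉D , A~B , A~D) dB dD a≢b a≢c b≢c
  with classify B dB A~B A≉B | classify D dD A~D A≉D
... | inj₁ B≈ | inj₁ D≈ = contradiction (≈c-trans B≈ (≈c-sym D≈)) B≉D
... | inj₂ B≈ | inj₂ D≈ = contradiction (≈c-trans B≈ (≈c-sym D≈)) B≉D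
... | inj₁ B≈ | inj₂ D≈ =
  exactly-one-map (⇔-id _) (sat-≈ α (≈c-sym B≈)) (sat-≈ α (≈c-sym D≈))
    (canonical-exactly-one α a b c a≢b a≢c b≢c)
... | inj₂ B≈ | inj₁ D≈ =
  exactly-one-map (⇔-id _) (sat-≈ α (≈c-sym B≈)) (sat-≈ α (≈c-sym D≈))
    (exactly-one-swap (canonical-exactly-one α a b c a≢b a≢c b≢c))

numSat-accept : ∀ α {c} xs → Sat α c → numSat α (c ∷ xs) ≡ suc (numSat α xs)
numSat-accept α xs s = cong length (filter-accept (sat? α) s)

numSat-reject : ∀ α {c} xs → ¬ Sat α c → numSat α (c ∷ xs) ≡ numSat α xs
numSat-reject α xs ¬s = cong length (filter-reject (sat? α) ¬s)

numSat-exactly-one : ∀ α {A B D} xs → ExactlyOne (Sat α A) (Sat α B) (Sat α D) →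
                     numSat α (A ∷ B ∷ D ∷ xs) ≡ suc (numSat α xs)
numSat-exactly-one α xs (inj₁ (a , ¬b , ¬d)) =
  trans (numSat-accept α _ a) (cong suc (trans (numSat-reject α _ ¬b) (numSat-reject α xs ¬d)))
numSat-exactly-one α xs (inj₂ (inj₁ (¬a , b , ¬d))) =
  trans (numSat-reject α _ ¬a) (trans (numSat-accept α _ b) (cong suc (numSat-reject α xs ¬d)))
numSat-exactly-one α xs (inj₂ (inj₂ (¬a , ¬b , d))) =
  trans (numSat-reject α _ ¬a) (trans (numSat-reject α _ ¬b) (numSat-accept α xs d))

PreservesOrder : (Var → ℕ) → (Var → ℕ) → Constraint → Set
PreservesOrder α γ c = ∀ {x y} → InVars x c → InVars y c → α x < α y → γ x < γ y

sat-transfer : ∀ {α γ c} → PreservesOrder α γ c → Sat α c → Sat γ c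
sat-transfer pres (inj₁ (l , r)) = inj₁ (pres (inj₂ (inj₁ refl)) (inj₁ refl) l , pres (inj₁ refl) (inj₂ (inj₂ refl)) r)
sat-transfer pres (inj₂ (l , r)) = inj₂ (pres (inj₂ (inj₂ refl)) (inj₁ refl) l , pres (inj₁ refl) (inj₂ (inj₁ refl)) r)

numSat-transfer : ∀ α γ C → (∀ {c} → c ∈ C → PreservesOrder α γ c) → numSat α C ≤ numSat γ C
numSat-transfer α γ C pres = count-mono (sat? α) (sat? γ) C (sat-transfer ∘ pres)

ConstraintsOver : List Var → List Constraint → Set
ConstraintsOver V C =
  ∀ c → c ∈ C → mid c ≢ e₁ c × mid c ≢ e₂ c × e₁ c ≢ e₂ c × mid c ∈ V × e₁ c ∈ V × e₂ c ∈ V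

var-in : ∀ {V C c x} → ConstraintsOver V C → c ∈ C → InVars x c → x ∈ V
var-in over c∈ (inj₁ refl)        with over _ c∈
... | _ , _ , _ , m∈ , _ = m∈
var-in over c∈ (inj₂ (inj₁ refl)) with over _ c∈
... | _ , _ , _ , _ , p∈ , _ = p∈
var-in over c∈ (inj₂ (inj₂ refl)) with over _ c∈
... | _ , _ , _ , _ , _ , q∈ = q∈

Meets : (Var → ℕ) → List Constraint → ℕ → Set
Meets α C κ = length C + 3 * κ ≤ 3 * numSat α C

meets-mono : ∀ α γ C κ → numSat α C ≤ numSat γ C → Meets α C κ → Meets γ C κ
meets-mono _ _ _ _ α≤γ m = ≤-trans m (*-monoʳ-≤ 3 α≤γ)

meets-shift : ∀ {α C C' κ} → length C ≡ 3 + length C' → numSat α C ≡ suc (numSat α C') →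
              Meets α C κ ⇔ Meets α C' κ
meets-shift {α} {C} {C'} {κ} lenC nsC rewrite lenC | nsC | *-suc 3 (numSat α C') =
  mk⇔ (+-cancelˡ-≤ 3 _ _) (+-monoʳ-≤ 3)

-- Extend an ordering of V' injectively to all variables, placing the
-- variables outside V' after |V'|.
extend : List Var → (Var → ℕ) → Var → ℕ
extend V' α' v with v ∈? V'
... | yes _ = α' v
... | no _  = suc (length V') + v

-- The extension agrees with α' on V' and is injective everywhere, since α'
-- maps V' into {1,…,|V'|}.
extend-agrees : ∀ V' α' {v} → v ∈ V' → extend V' α' v ≡ α' v
extend-agrees V' α' {v} v∈ with v ∈? V'
... | yes _  = refl
... | no v∉ = contradiction v∈ v∉

extend-injective : ∀ V' α' → IsBijection V' α' → ∀ {u v} → extend V' α' u ≡ extend V' α' v → u ≡ v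
extend-injective V' α' (range , inj , _) {u} {v} with u ∈? V' | v ∈? V'
... | yes u∈ | yes v∈ = inj u v u∈ v∈
... | yes u∈ | no _   = λ eq → contradiction (subst (_≤ length V') eq (proj₂ (range u u∈)))
                                              (<⇒≱ (s≤s (m≤m+n (length V') v)))
... | no _   | yes v∈ = λ eq → contradiction (subst (_≤ length V') (sym eq) (proj₂ (range v v∈)))
                                              (<⇒≱ (s≤s (m≤m+n (length V') u)))
... | no _   | no _   = +-cancelˡ-≡ (suc (length V')) u v

module OneStep {V C V' C' A B D} (uV : Unique V) (over : ConstraintsOver V C)
  (complete : CompleteTriple A B D) (perm : C ↭ A ∷ B ∷ D ∷ C') (uV' : Unique V')
  (memV' : ∀ v → v ∈ V' ⇔ (v ∈ V × ¬ (InVars v A × (∀ c → c ∈ C' → ¬ InVars v c)))) where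

  ∈C : ∀ {c} → c ∈ A ∷ B ∷ D ∷ C' → c ∈ C
  ∈C = ∈-resp-↭ (↭-sym perm)

  V'⊆V : ∀ {v} → v ∈ V' → v ∈ V
  V'⊆V = proj₁ ∘ to (memV' _)

  -- A variable of a surviving constraint is not deleted.
  over' : ConstraintsOver V' C'
  over' c c∈ with over c (∈C (there (there (there c∈))))
  ... | m≢p , m≢q , p≢q , m∈ , p∈ , q∈ = m≢p , m≢q , p≢q , keep m∈ (inj₁ refl) ,
                                          keep p∈ (inj₂ (inj₁ refl)) , keep q∈ (inj₂ (inj₂ refl))
    where
    keep : ∀ {x} → x ∈ V → InVars x c → x ∈ V'
    keep x∈ x∈c = from (memV' _) (x∈ , λ (_ , only) → only c c∈ x∈c)

  distinct : ∀ {X} → X ∈ A ∷ B ∷ D ∷ C' → Distinct X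
  distinct X∈ with over _ (∈C X∈)
  ... | m≢p , m≢q , p≢q , _ = m≢p , m≢q , p≢q

  length-C : length C ≡ 3 + length C'
  length-C = ↭-length perm

  numSat-C : ∀ α → InjectiveOn V α → numSat α C ≡ suc (numSat α C')
  numSat-C α inj with over A (∈C (here refl))
  ... | m≢p , m≢q , p≢q , m∈ , p∈ , q∈ = begin
    numSat α C                    ≡⟨ ↭-length (filter-↭ (sat? α) perm) ⟩
    numSat α (A ∷ B ∷ D ∷ C')     ≡⟨ numSat-exactly-one α C' one ⟩
    suc (numSat α C')             ∎
    where
    open ≡-Reasoning
    one : ExactlyOne (Sat α A) (Sat α B) (Sat α D)
    one = complete-triple-exactly-one α complete
            (distinct (there (here refl))) (distinct (there (there (here refl))))
            (m≢p ∘ inj _ _ m∈ p∈) (m≢q ∘ inj _ _ m∈ q∈) (p≢q ∘ inj _ _ p∈ q∈)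

  forward : ∀ {κ} → YesInstance V C κ → YesInstance V' C' κ
  forward {κ} (α , (_ , inj , _) , meets) =
    rank V' α , rank-bijection α V' uV' injV' ,
    meets-mono α (rank V' α) C' κ (numSat-transfer α (rank V' α) C' preserves)
               (to (meets-shift {α} {C} {C'} {κ} length-C (numSat-C α inj)) meets)
    where
    injV' : InjectiveOn V' α
    injV' u v u∈ v∈ = inj u v (V'⊆V u∈) (V'⊆V v∈)
    preserves : ∀ {c} → c ∈ C' → PreservesOrder α (rank V' α) c
    preserves c∈ _ y∈c = rank-strict α V' (var-in over' c∈ y∈c)

  backward : ∀ {κ} → YesInstance V' C' κ → YesInstance V C κ
  backward {κ} (α' , bij' , meets') =
    γ , bijγ , from (meets-shift {γ} {C} {C'} {κ} length-C (numSat-C γ (proj₁ (proj₂ bijγ))))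
                    (meets-mono α' γ C' κ (numSat-transfer α' γ C' preserves) meets')
    where
    β γ : Var → ℕ
    β = extend V' α'
    γ = rank V β
    bijγ : IsBijection V γ
    bijγ = rank-bijection β V uV (λ _ _ _ _ → extend-injective V' α' bij')
    preserves : ∀ {c} → c ∈ C' → PreservesOrder α' γ c
    preserves c∈ {x} {y} x∈c y∈c α'< =
      rank-strict β V (V'⊆V y∈V') (subst₂ _<_ (sym (extend-agrees V' α' x∈V'))
                                               (sym (extend-agrees V' α' y∈V')) α'<)
      where
      x∈V' : x ∈ V'
      x∈V' = var-in over' c∈ x∈c
      y∈V' : y ∈ V'
      y∈V' = var-in over' c∈ y∈c

chain-preserves : ∀ {V C V' C'} κ → Star Step (V , C) (V' , C') → Unique V → ConstraintsOver V C →
                  YesInstance V C κ ⇔ YesInstance V' C' κ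
chain-preserves κ ε _ _ = ⇔-id _
chain-preserves κ ((A , B , D , complete , perm , uV₁ , memV₁) ◅ rest) uV over =
  chain-preserves κ rest uV₁ over₁ ⇔-∘ mk⇔ (forward {κ}) (backward {κ})
  where open OneStep uV over complete perm uV₁ memV₁ renaming (over' to over₁)

lemma3 : (V : List Var) (C : List Constraint) (κ : ℕ)
         (V' : List Var) (C' : List Constraint) →
         WellFormed V C →
         Exhaustive (V , C) (V' , C') →
         YesInstance V C κ ⇔ YesInstance V' C' κ
lemma3 V C κ V' C' (uV , _ , over) (chain , _) = chain-preserves κ chain uV over
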